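{- Let $\Lambda$ be a graph, let $v$ be a vertex of $\Lambda$ and let $A$ and $B$ be vertex-transitive groups of automorphisms of $\Lambda$ such that $B\trianglelefteq A$. Then for every permutation group $L$ with $B_v^{\Lambda(v)}\le L\le A_v^{\Lambda(v)}$ there exists a group $C$ with $B\le C\le A$, $C_v^{\Lambda(v)}=L$ and $C_v^{[1]}=A_v^{[1]}$.
   Context: Graphs are finite and simple. For $X\le\mathrm{Aut}(\Lambda)$, $X_v$ is the stabiliser of $v$, $X_v^{\Lambda(v)}$ is the permutation group induced by $X_v$ on the neighbourhood $\Lambda(v)$, and $X_v^{[1]}$ is the kernel of the action of $X_v$ on $\Lambda(v)$. -}

module Defs where

open import Data.Nat.Base using (ℕ)
open import Data.Fin.Base using (Fin)
open import Data.Bool.Base using (Bool; T; false)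
open import Data.Product.Base using (Σ; ∃; _×_; _,_; proj₁)
open import Function.Bundles using (_↔_; Inverse)
open import Function.Construct.Identity using (↔-id)
open import Function.Construct.Symmetry using (↔-sym)
open import Function.Construct.Composition using (_↔-∘_)
open import Relation.Binary.PropositionalEquality using (_≡_)
open import Relation.Nullary using (¬_)
open import Level using (0ℓ)
open import Relation.Unary using (Pred; _⊆_)

record Graph : Set where
  field
    n     : ℕ
    adj   : Fin n → Fin n → Bool
    sym   : ∀ u w → adj u w ≡ adj w u
    irrefl : ∀ u → adj u u ≡ false

open Graph public

Vertex : Graph → Set
Vertex Λ = Fin (n Λ)

Adj : (Λ : Graph) → Vertex Λ → Vertex Λ → Set
Adj Λ u w = T (adj Λ u w)

Nbhd : (Λ : Graph) → Vertex Λ → Set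
Nbhd Λ v = Σ (Vertex Λ) (Adj Λ v)

Sym : Set → Set
Sym T = T ↔ T

app : {T : Set} → Sym T → T → T
app = Inverse.to

_≗ₚ_ : {T : Set} → Sym T → Sym T → Set
g ≗ₚ h = ∀ x → app g x ≡ app h x

record IsPermGroup {T : Set} (G : Pred (Sym T) 0ℓ) : Set where
  field
    resp  : ∀ {g h} → g ≗ₚ h → G g → G h
    id∈   : G (↔-id T)
    comp∈ : ∀ {g h} → G g → G h → G (g ↔-∘ h)
    inv∈  : ∀ {g} → G g → G (↔-sym g)

_≐_ : {A : Set} → Pred A 0ℓ → Pred A 0ℓ → Set
P ≐ Q = (P ⊆ Q) × (Q ⊆ P)

IsAut : (Λ : Graph) → Sym (Vertex Λ) → Set
IsAut Λ g = ∀ u w → adj Λ (app g u) (app g w) ≡ adj Λ u w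

IsAutGroup : (Λ : Graph) → Pred (Sym (Vertex Λ)) 0ℓ → Set
IsAutGroup Λ X = IsPermGroup X × (∀ {g} → X g → IsAut Λ g)

VertexTransitive : (Λ : Graph) → Pred (Sym (Vertex Λ)) 0ℓ → Set
VertexTransitive Λ X = ∀ u w → ∃ λ g → X g × app g u ≡ w

NormalIn : {T : Set} → Pred (Sym T) 0ℓ → Pred (Sym T) 0ℓ → Set
NormalIn B A = (B ⊆ A) × (∀ {a b} → A a → B b → B ((a ↔-∘ b) ↔-∘ ↔-sym a))

LocalAction : (Λ : Graph) (X : Pred (Sym (Vertex Λ)) 0ℓ) (v : Vertex Λ) →
              Pred (Sym (Nbhd Λ v)) 0ℓ
LocalAction Λ X v σ =
  ∃ λ g → X g × app g v ≡ v × (∀ x → proj₁ (app σ x) ≡ app g (proj₁ x))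

Kernel : (Λ : Graph) (X : Pred (Sym (Vertex Λ)) 0ℓ) (v : Vertex Λ) →
         Pred (Sym (Vertex Λ)) 0ℓ
Kernel Λ X v g = X g × app g v ≡ v × (∀ u → Adj Λ v u → app g u ≡ u)

-- Take H := { a ∈ A_v : a^{Λ(v)} ∈ L } and C := B H, a group because B ⊴ A.
-- An element b h of C fixes v exactly when b does, so C_v = B_v H and
-- C_v^{Λ(v)} = B_v^{Λ(v)} L = L; moreover A_v^{[1]} ≤ H ≤ C.
module Submission where

open import Defs hiding (sym)
open import Level using (0ℓ)
open import Relation.Unary using (Pred; _⊆_; _∩_)
open import Data.Product.Base using (Σ; ∃; _×_; _,_; proj₁; proj₂)
open import Function.Bundles using (Inverse)
open import Function.Construct.Identity using (↔-id)
open import Function.Construct.Symmetry using (↔-sym)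
open import Function.Construct.Composition using (_↔-∘_)
open import Relation.Binary.PropositionalEquality

open Inverse using (to; from; strictlyInverseˡ; strictlyInverseʳ)

module _ {T : Set} where

  ∩-isPermGroup : {G H : Pred (Sym T) 0ℓ} →
                  IsPermGroup G → IsPermGroup H → IsPermGroup (G ∩ H)
  ∩-isPermGroup G-grp H-grp = record
    { resp  = λ e (Gg , Hg) → G.resp e Gg , H.resp e Hg
    ; id∈   = G.id∈ , H.id∈
    ; comp∈ = λ (Gg , Hg) (Gh , Hh) → G.comp∈ Gg Gh , H.comp∈ Hg Hh
    ; inv∈  = λ (Gg , Hg) → G.inv∈ Gg , H.inv∈ Hg
    }
    where
    module G = IsPermGroup G-grp
    module H = IsPermGroup H-grp

  -- The product set B H, with g = b h encoded as b⁻¹ g ∈ H.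
  _·_ : Pred (Sym T) 0ℓ → Pred (Sym T) 0ℓ → Pred (Sym T) 0ℓ
  (B · H) g = ∃ λ b → B b × H (↔-sym b ↔-∘ g)

  module _ {B H : Pred (Sym T) 0ℓ} where

    ⊆-·ˡ : IsPermGroup H → B ⊆ B · H
    ⊆-·ˡ H-grp {b} Bb =
      b , Bb , IsPermGroup.resp H-grp (λ x → sym (strictlyInverseʳ b x))
                                      (IsPermGroup.id∈ H-grp)

    ⊆-·ʳ : IsPermGroup B → IsPermGroup H → H ⊆ B · H
    ⊆-·ʳ B-grp H-grp Hh =
      ↔-id T , IsPermGroup.id∈ B-grp , IsPermGroup.resp H-grp (λ _ → refl) Hh

    ·-⊆ : {A : Pred (Sym T) 0ℓ} → IsPermGroup A → B ⊆ A → H ⊆ A → B · H ⊆ A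
    ·-⊆ A-grp B⊆A H⊆A {g} (b , Bb , Hh) =
      A.resp (λ x → strictlyInverseˡ b (to g x)) (A.comp∈ (B⊆A Bb) (H⊆A Hh))
      where module A = IsPermGroup A-grp

    ·-isPermGroup : {A : Pred (Sym T) 0ℓ} → IsPermGroup A → IsPermGroup B → IsPermGroup H →
                    NormalIn B A → H ⊆ A → IsPermGroup (B · H)
    ·-isPermGroup A-grp B-grp H-grp (_ , B⊴A) H⊆A = record
      { resp  = λ e (b , Bb , Hh) → b , Bb , H.resp (λ x → cong (from b) (e x)) Hh
      ; id∈   = ⊆-·ʳ B-grp H-grp H.id∈
      ; comp∈ = λ {g} {g′} → comp∈ {g} {g′}
      ; inv∈  = λ {g} → inv∈ {g}
      }
      where
      module A = IsPermGroup A-grp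
      module B = IsPermGroup B-grp
      module H = IsPermGroup H-grp

      -- b h b′ h′ = (b · h b′ h⁻¹) · h h′
      comp∈ : ∀ {g g′} → (B · H) g → (B · H) g′ → (B · H) (g ↔-∘ g′)
      comp∈ {g} {g′} (b , Bb , Hh) (b′ , Bb′ , Hh′) =
        b ↔-∘ ((h ↔-∘ b′) ↔-∘ ↔-sym h) , B.comp∈ Bb (B⊴A (H⊆A Hh) Bb′) ,
        H.resp (λ x → cong (λ y → to h (from b′ y))
                           (sym (trans (cong (from g) (strictlyInverseˡ b _))
                                       (strictlyInverseʳ g (to g′ x)))))
               (H.comp∈ Hh Hh′)
        where h = ↔-sym b ↔-∘ g

      -- (b h)⁻¹ = (h⁻¹ b⁻¹ h) · h⁻¹
      inv∈ : ∀ {g} → (B · H) g → (B · H) (↔-sym g)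
      inv∈ {g} (b , Bb , Hh) =
        (↔-sym h ↔-∘ ↔-sym b) ↔-∘ ↔-sym (↔-sym h) ,
        B⊴A (A.inv∈ (H⊆A Hh)) (B.inv∈ Bb) ,
        H.resp (λ x → cong (λ y → from g (to b y))
                           (sym (trans (strictlyInverseˡ b _) (strictlyInverseˡ g x))))
               (H.inv∈ Hh)
        where h = ↔-sym b ↔-∘ g

module _ (Λ : Graph) (v : Vertex Λ) where

  private V = Vertex Λ

  Induces : Sym (Nbhd Λ v) → Sym V → Set
  Induces σ g = ∀ x → proj₁ (to σ x) ≡ to g (proj₁ x)

  induces-resp : ∀ {σ g h} → g ≗ₚ h → Induces σ g → Induces σ h
  induces-resp g≗h σ∼g x = trans (σ∼g x) (g≗h (proj₁ x))

  induces-id : Induces (↔-id _) (↔-id V)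
  induces-id _ = refl

  induces-∘ : ∀ {σ τ g h} → Induces σ g → Induces τ h → Induces (σ ↔-∘ τ) (g ↔-∘ h)
  induces-∘ {τ = τ} {g} σ∼g τ∼h x = trans (σ∼g (to τ x)) (cong (to g) (τ∼h x))

  induces-sym : ∀ {σ g} → Induces σ g → Induces (↔-sym σ) (↔-sym g)
  induces-sym {σ} {g} σ∼g x = begin
    proj₁ (from σ x)                   ≡⟨ strictlyInverseʳ g _ ⟨
    from g (to g (proj₁ (from σ x)))   ≡⟨ cong (from g) (σ∼g (from σ x)) ⟨
    from g (proj₁ (to σ (from σ x)))   ≡⟨ cong (λ y → from g (proj₁ y)) (strictlyInverseˡ σ x) ⟩
    from g (proj₁ x)                   ∎
    where open ≡-Reasoning

  LocalPreimage : Pred (Sym (Nbhd Λ v)) 0ℓ → Pred (Sym V) 0ℓ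
  LocalPreimage L g = to g v ≡ v × ∃ λ σ → L σ × Induces σ g

  module _ {L : Pred (Sym (Nbhd Λ v)) 0ℓ} (L-grp : IsPermGroup L) where

    private module L = IsPermGroup L-grp

    LocalPreimage-isPermGroup : IsPermGroup (LocalPreimage L)
    LocalPreimage-isPermGroup = record
      { resp  = λ {g} {h} e (gv , σ , Lσ , σ∼g) →
          trans (sym (e v)) gv , σ , Lσ , induces-resp {σ} {g} {h} e σ∼g
      ; id∈   = refl , ↔-id _ , L.id∈ , induces-id
      ; comp∈ = λ {g} {h} (gv , σ , Lσ , σ∼g) (hv , τ , Lτ , τ∼h) →
          trans (cong (to g) hv) gv ,
          σ ↔-∘ τ , L.comp∈ Lσ Lτ , induces-∘ {σ} {τ} {g} {h} σ∼g τ∼h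
      ; inv∈  = λ {g} (gv , σ , Lσ , σ∼g) →
          trans (cong (from g) (sym gv)) (strictlyInverseʳ g v) ,
          ↔-sym σ , L.inv∈ Lσ , induces-sym {σ} {g} σ∼g
      }

    Kernel⊆LocalPreimage : ∀ {X} → Kernel Λ X v ⊆ LocalPreimage L
    Kernel⊆LocalPreimage (_ , gv , fixes) =
      gv , ↔-id _ , L.id∈ , λ (u , v∼u) → sym (fixes u v∼u)

    -- If g = b h fixes v then so does b, and b induces σ ∘ ρ⁻¹ where h induces ρ.
    LocalAction-· : ∀ {B H} → H ⊆ LocalPreimage L → LocalAction Λ B v ⊆ L →
                    LocalAction Λ (B · H) v ⊆ L
    LocalAction-· {B} H⊆ B≤L {σ} (g , (b , Bb , Hh) , gv , σ∼g) with H⊆ Hh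
    ... | hv , ρ , Lρ , ρ∼h =
      L.resp {σ′ ↔-∘ ρ} {σ} (λ x → cong (to σ) (strictlyInverseʳ ρ x))
             (L.comp∈ {σ′} {ρ} (B≤L b-local) Lρ)
      where
      h = ↔-sym b ↔-∘ g
      σ′ = σ ↔-∘ ↔-sym ρ
      bv : to b v ≡ v
      bv = begin
        to b v                     ≡⟨ cong (to b) hv ⟨
        to b (from b (to g v))     ≡⟨ strictlyInverseˡ b (to g v) ⟩
        to g v                     ≡⟨ gv ⟩
        v                          ∎
        where open ≡-Reasoning
      b-local : LocalAction Λ B v σ′
      b-local = b , Bb , bv ,
        induces-resp {σ′} {g ↔-∘ ↔-sym h} {b} (λ x → strictlyInverseˡ g (to b x))
                     (induces-∘ {σ} {↔-sym ρ} {g} {↔-sym h} σ∼g (induces-sym {ρ} {h} ρ∼h))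

  LocalAction-mono : ∀ {X Y} → X ⊆ Y → LocalAction Λ X v ⊆ LocalAction Λ Y v
  LocalAction-mono X⊆Y (g , Xg , rest) = g , X⊆Y Xg , rest

  Kernel-mono : ∀ {X Y} → X ⊆ Y → Kernel Λ X v ⊆ Kernel Λ Y v
  Kernel-mono X⊆Y (Xg , rest) = X⊆Y Xg , rest

  LocalAction-∩-LocalPreimage : ∀ {X L} → L ⊆ LocalAction Λ X v →
                                L ⊆ LocalAction Λ (X ∩ LocalPreimage L) v
  LocalAction-∩-LocalPreimage L≤X {σ} Lσ with L≤X Lσ
  ... | g , Xg , gv , σ∼g = g , (Xg , gv , σ , Lσ , σ∼g) , gv , σ∼g

lemma5p2 : (Λ : Graph) (v : Vertex Λ)
    (A B : Pred (Sym (Vertex Λ)) 0ℓ) →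
    IsAutGroup Λ A → IsAutGroup Λ B →
    VertexTransitive Λ A → VertexTransitive Λ B →
    NormalIn B A →
    (L : Pred (Sym (Nbhd Λ v)) 0ℓ) → IsPermGroup L →
    LocalAction Λ B v ⊆ L → L ⊆ LocalAction Λ A v →
    Σ (Pred (Sym (Vertex Λ)) 0ℓ) λ C →
    IsAutGroup Λ C × (B ⊆ C) × (C ⊆ A) ×
    (LocalAction Λ C v ≐ L) × (Kernel Λ C v ≐ Kernel Λ A v)
lemma5p2 Λ v A B (A-grp , A-aut) (B-grp , _) _ _ B⊴A L L-grp B≤L L≤A =
  C , (C-grp , λ {g} Cg → A-aut (C⊆A {g} Cg)) , ⊆-·ˡ {H = H} H-grp , C⊆A ,
  (C≤L , L≤C) , (C₁⊆A₁ , A₁⊆C₁)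
  where
  H C : Pred (Sym (Vertex Λ)) 0ℓ
  H = A ∩ LocalPreimage Λ v L
  C = B · H

  H-grp : IsPermGroup H
  H-grp = ∩-isPermGroup A-grp (LocalPreimage-isPermGroup Λ v L-grp)

  C-grp : IsPermGroup C
  C-grp = ·-isPermGroup A-grp B-grp H-grp B⊴A proj₁

  H⊆C : H ⊆ C
  H⊆C = ⊆-·ʳ {B = B} B-grp H-grp

  C⊆A : C ⊆ A
  C⊆A = ·-⊆ {B = B} {H} A-grp (proj₁ B⊴A) proj₁

  C≤L : LocalAction Λ C v ⊆ L
  C≤L = LocalAction-· Λ v L-grp {B} {H} proj₂ B≤L

  L≤C : L ⊆ LocalAction Λ C v
  L≤C {σ} Lσ =
    LocalAction-mono Λ v {H} {C} H⊆C {σ} (LocalAction-∩-LocalPreimage Λ v {A} {L} L≤A Lσ)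

  C₁⊆A₁ : Kernel Λ C v ⊆ Kernel Λ A v
  C₁⊆A₁ = Kernel-mono Λ v {C} {A} C⊆A

  A₁⊆C₁ : Kernel Λ A v ⊆ Kernel Λ C v
  A₁⊆C₁ k@(Ag , rest) = H⊆C (Ag , Kernel⊆LocalPreimage Λ v L-grp {A} k) , rest
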